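{- Let $\Gamma\subseteq\mathrm{For}(\mathcal{L})$ be consistent, let $\Delta$ be a maximal consistent set of formulae containing $\Gamma$, and let $\varphi$ be a formula. Then $$\sup\{p\in\mathbb{D}:p\mathbin{\dot{ - }}\varphi\in\Delta\}=\inf\{q\in\mathbb{D}:\varphi\mathbin{\dot{ - }}q\in\Delta\}.$$
   Context: $\mathcal{L}$ is a continuous signature: a nonempty set $\mathcal{R}$ of relation symbols, a set $\mathcal{F}$ of function symbols disjoint from $\mathcal{R}$, arities $n_s<\omega$, and functions $\delta_{s,i}:(0,1]\to(0,1]$ for $i<n_s$; possibly with a distinguished binary relation symbol $d$ (metric). Formulae: $Pt_0\cdots t_{n_P-1}$, $\varphi\mathbin{\dot{ - }}\psi$, $\neg\varphi$, $\tfrac12\varphi$, $\sup_x\varphi$. Abbreviations: $\varphi\wedge\psi:=\varphi\mathbin{\dot{ - }}(\varphi\mathbin{\dot{ - }}\psi)$, $1:=\neg(\varphi\mathbin{\dot{ - }}\varphi)$, $2^{ -n}:=\tfrac12\cdots\tfrac12 1$ ($n$ times); $\mathbb{D}$ is the set of dyadic rationals in $[0,1]$, each identified with a closed formula built from $1$ by $\neg,\mathbin{\dot{ - }},\tfrac12$ denoting it. Proof system. Axioms: all generalizations $\sup_{x_1}\cdots\sup_{x_n}\chi$ ($n\ge0$) of instances of (A1) $(\varphi\mathbin{\dot{ - }}\psi)\mathbin{\dot{ - }}\varphi$; (A2) $((\chi\mathbin{\dot{ - }}\varphi)\mathbin{\dot{ - }}(\chi\mathbin{\dot{ - }}\psi))\mathbin{\dot{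 - }}(\psi\mathbin{\dot{ - }}\varphi)$; (A3) $(\varphi\mathbin{\dot{ - }}(\varphi\mathbin{\dot{ - }}\psi))\mathbin{\dot{ - }}(\psi\mathbin{\dot{ - }}(\psi\mathbin{\dot{ - }}\varphi))$; (A4) $(\varphi\mathbin{\dot{ - }}\psi)\mathbin{\dot{ - }}(\neg\psi\mathbin{\dot{ - }}\neg\varphi)$; (A5) $\tfrac12\varphi\mathbin{\dot{ - }}(\varphi\mathbin{\dot{ - }}\tfrac12\varphi)$; (A6) $(\varphi\mathbin{\dot{ - }}\tfrac12\varphi)\mathbin{\dot{ - }}\tfrac12\varphi$; (A7) $(\sup_x\psi\mathbin{\dot{ - }}\sup_x\varphi)\mathbin{\dot{ - }}\sup_x(\psi\mathbin{\dot{ - }}\varphi)$; (A8) $\varphi[t/x]\mathbin{\dot{ - }}\sup_x\varphi$ (free substitution, no variable of $t$ becoming bound); (A9) $\sup_x\varphi\mathbin{\dot{ - }}\varphi$ ($x$ not free in $\varphi$); with a metric also (A10) $dxx$; (A11) $dxy\mathbin{\dot{ - }}dyx$; (A12) $(dxz\mathbin{\dot{ - }}dxy)\mathbin{\dot{ - }}dyz$; (A13) $(q\mathbin{\dot{ - }}dzw)\wedge(d\,f\bar xz\bar y\,f\bar xw\bar y\mathbin{\dot{ - }}r)$ for $f\in\mathcal{F}$, $|\bar x|=i<n_f$, $\epsilon\in(0,1]$, $r,q\in\mathbb{D}$, $r>\epsilon$, $q<\delta_{f,i}(\epsilon)$; (A14) $(q\mathbin{\dot{ - }}dzw)\wedge((P\bar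 xz\bar y\mathbin{\dot{ - }}P\bar xw\bar y)\mathbin{\dot{ - }}r)$ analogously for $P\in\mathcal{R}$. Sole rule: modus ponens (from $\varphi$ and $\psi\mathbin{\dot{ - }}\varphi$ infer $\psi$). $\Gamma\vdash_Q\varphi$ iff $\varphi$ has a finite derivation from axioms and members of $\Gamma$; inconsistent means proving every formula. A set $\Delta$ is maximal consistent if it is consistent and for all formulae $\varphi,\psi$: (i) if $\Delta\vdash_Q\varphi\mathbin{\dot{ - }}2^{ -n}$ for all $n<\omega$ then $\varphi\in\Delta$; (ii) $\varphi\mathbin{\dot{ - }}\psi\in\Delta$ or $\psi\mathbin{\dot{ - }}\varphi\in\Delta$. -}

module Defs where

open import Data.Nat using (ℕ; zero; suc; _+_; _*_; _∸_; _^_; _≤_; _<_; _≤ᵇ_; _≡ᵇ_)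
open import Data.Nat.Properties using (_≟_)
open import Data.Fin using (Fin)
open import Data.Vec using (Vec; []; _∷_; _[_]≔_; replicate)
open import Data.Bool using (if_then_else_)
open import Data.Maybe using (Maybe; just)
open import Data.Product using (Σ; _×_; _,_)
open import Data.Sum using (_⊎_)
open import Data.Empty using (⊥)
open import Data.Unit using (⊤)
open import Data.List using (List)
open import Function using (_∘_)
open import Relation.Nullary using (¬_; yes; no)
open import Relation.Binary.PropositionalEquality using (_≡_; _≢_; subst; sym)
import Data.Vec as V

-- Dyadic rationals in [0,1]: num / 2^exp with num ≤ 2^exp.

record Dyadic : Set where
  constructor dyadic
  field
    num : ℕ
    exp : ℕ
    bounded : num ≤ 2 ^ exp
open Dyadic public

_≤ᴰ_ : Dyadic → Dyadic → Set
p ≤ᴰ q = num p * 2 ^ exp q ≤ num q * 2 ^ exp p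

_<ᴰ_ : Dyadic → Dyadic → Set
p <ᴰ q = num p * 2 ^ exp q < num q * 2 ^ exp p

-- value(q) ≤ value(p) + 2^{-n}, cleared of denominators
Within : ℕ → Dyadic → Dyadic → Set
Within n p q =
  num q * 2 ^ exp p * 2 ^ n ≤ num p * 2 ^ exp q * 2 ^ n + 2 ^ exp p * 2 ^ exp q

record Signature : Set₁ where
  field
    Rel    : Set
    Fun    : Set
    someRel : Rel
    rarity : Rel → ℕ
    farity : Fun → ℕ
    FunMod : (f : Fun) → Fin (farity f) → Dyadic → Dyadic → Set
    RelMod : (P : Rel) → Fin (rarity P) → Dyadic → Dyadic → Set
    metric : Maybe (Σ Rel (λ d → rarity d ≡ 2))

module Syntax (L : Signature) where
  open Signature L

  Var : Set
  Var = ℕ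

  data Term : Set where
    var : Var → Term
    app : (f : Fun) → Vec Term (farity f) → Term

  infixl 6 _⊖_
  data Formula : Set where
    rel  : (P : Rel) → Vec Term (rarity P) → Formula
    _⊖_  : Formula → Formula → Formula
    neg  : Formula → Formula
    half : Formula → Formula
    sup  : Var → Formula → Formula

  _∧̇_ : Formula → Formula → Formula
  φ ∧̇ ψ = φ ⊖ (φ ⊖ ψ)

  σ₀ : Formula
  σ₀ = sup 0 (rel someRel (replicate _ (var 0)))

  one : Formula
  one = neg (σ₀ ⊖ σ₀)

  zeroF : Formula
  zeroF = one ⊖ one

  twoPow⁻ : ℕ → Formula
  twoPow⁻ zero = one
  twoPow⁻ (suc n) = half (twoPow⁻ n)

  -- closed formula built from 1 by ¬, ∸, ½ denoting m / 2^k  (m ≤ 2^k)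
  dyF : ℕ → ℕ → Formula
  dyF m zero = if m ≡ᵇ 0 then zeroF else one
  dyF m (suc k) =
    if m ≤ᵇ 2 ^ k then half (dyF m k)
    else neg (half (neg (dyF (m ∸ 2 ^ k) k)))

  ⌜_⌝ : Dyadic → Formula
  ⌜ p ⌝ = dyF (num p) (exp p)

  mutual
    OccT : Var → Term → Set
    OccT x (var y) = x ≡ y
    OccT x (app f ts) = OccV x ts

    OccV : ∀ {n} → Var → Vec Term n → Set
    OccV x [] = ⊥
    OccV x (t ∷ ts) = OccT x t ⊎ OccV x ts

  Free : Var → Formula → Set
  Free x (rel P ts) = OccV x ts
  Free x (φ ⊖ ψ) = Free x φ ⊎ Free x ψ
  Free x (neg φ) = Free x φ
  Free x (half φ) = Free x φ
  Free x (sup y φ) = x ≢ y × Free x φ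

  mutual
    substT : Term → Var → Term → Term
    substT t x (var y) with x ≟ y
    ... | yes _ = t
    ... | no _ = var y
    substT t x (app f ts) = app f (substV t x ts)

    substV : ∀ {n} → Term → Var → Vec Term n → Vec Term n
    substV t x [] = []
    substV t x (s ∷ ss) = substT t x s ∷ substV t x ss

  _[_/_] : Formula → Term → Var → Formula
  rel P ts [ t / x ] = rel P (substV t x ts)
  (φ ⊖ ψ) [ t / x ] = (φ [ t / x ]) ⊖ (ψ [ t / x ])
  neg φ [ t / x ] = neg (φ [ t / x ])
  half φ [ t / x ] = half (φ [ t / x ])
  sup y φ [ t / x ] with x ≟ y
  ... | yes _ = sup y φ
  ... | no _ = sup y (φ [ t / x ])

  FreeFor : Term → Var → Formula → Set
  FreeFor t x (rel P ts) = ⊤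
  FreeFor t x (φ ⊖ ψ) = FreeFor t x φ × FreeFor t x ψ
  FreeFor t x (neg φ) = FreeFor t x φ
  FreeFor t x (half φ) = FreeFor t x φ
  FreeFor t x (sup y φ) = Free x (sup y φ) → (¬ OccT y t × FreeFor t x φ)

  dist : (d : Rel) → rarity d ≡ 2 → Term → Term → Formula
  dist d e s t = rel d (subst (Vec Term) (sym e) (s ∷ t ∷ []))

  data BaseAxiom : Formula → Set where
    A1 : ∀ φ ψ → BaseAxiom ((φ ⊖ ψ) ⊖ φ)
    A2 : ∀ φ ψ χ → BaseAxiom (((χ ⊖ φ) ⊖ (χ ⊖ ψ)) ⊖ (ψ ⊖ φ))
    A3 : ∀ φ ψ → BaseAxiom ((φ ⊖ (φ ⊖ ψ)) ⊖ (ψ ⊖ (ψ ⊖ φ)))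
    A4 : ∀ φ ψ → BaseAxiom ((φ ⊖ ψ) ⊖ (neg ψ ⊖ neg φ))
    A5 : ∀ φ → BaseAxiom (half φ ⊖ (φ ⊖ half φ))
    A6 : ∀ φ → BaseAxiom ((φ ⊖ half φ) ⊖ half φ)
    A7 : ∀ x φ ψ → BaseAxiom ((sup x ψ ⊖ sup x φ) ⊖ sup x (ψ ⊖ φ))
    A8 : ∀ x φ t → FreeFor t x φ → BaseAxiom ((φ [ t / x ]) ⊖ sup x φ)
    A9 : ∀ x φ → ¬ Free x φ → BaseAxiom (sup x φ ⊖ φ)
    A10 : ∀ {d e} → metric ≡ just (d , e) → ∀ x →
          BaseAxiom (dist d e (var x) (var x))
    A11 : ∀ {d e} → metric ≡ just (d , e) → ∀ x y →
          BaseAxiom (dist d e (var x) (var y) ⊖ dist d e (var y) (var x))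
    A12 : ∀ {d e} → metric ≡ just (d , e) → ∀ x y z →
          BaseAxiom ((dist d e (var x) (var z) ⊖ dist d e (var x) (var y))
                      ⊖ dist d e (var y) (var z))
    -- f x̄ z ȳ is written as f applied to xs with position i replaced by z
    A13 : ∀ {d e} → metric ≡ just (d , e) →
          (f : Fun) (i : Fin (farity f)) (xs : Vec Var (farity f))
          (z w : Var) (q r : Dyadic) → FunMod f i q r →
          BaseAxiom ((⌜ q ⌝ ⊖ dist d e (var z) (var w)) ∧̇
                     (dist d e (app f (V.map var (xs [ i ]≔ z)))
                               (app f (V.map var (xs [ i ]≔ w))) ⊖ ⌜ r ⌝))
    A14 : ∀ {d e} → metric ≡ just (d , e) →
          (P : Rel) (i : Fin (rarity P)) (xs : Vec Var (rarity P))
          (z w : Var) (q r : Dyadic) → RelMod P i q r →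
          BaseAxiom ((⌜ q ⌝ ⊖ dist d e (var z) (var w)) ∧̇
                     ((rel P (V.map var (xs [ i ]≔ z))
                        ⊖ rel P (V.map var (xs [ i ]≔ w))) ⊖ ⌜ r ⌝))

  data Axiom : Formula → Set where
    base : ∀ {χ} → BaseAxiom χ → Axiom χ
    gen  : ∀ {χ} x → Axiom χ → Axiom (sup x χ)

  data _⊢_ (Γ : Formula → Set) : Formula → Set where
    ax  : ∀ {φ} → Axiom φ → Γ ⊢ φ
    hyp : ∀ {φ} → Γ φ → Γ ⊢ φ
    mp  : ∀ {φ ψ} → Γ ⊢ φ → Γ ⊢ (ψ ⊖ φ) → Γ ⊢ ψ

  Consistent : (Formula → Set) → Set
  Consistent Γ = ¬ (∀ φ → Γ ⊢ φ)

  MaximalConsistent : (Formula → Set) → Set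
  MaximalConsistent Δ =
    Consistent Δ
    × (∀ φ → (∀ n → Δ ⊢ (φ ⊖ twoPow⁻ n)) → Δ φ)
    × (∀ φ ψ → Δ (φ ⊖ ψ) ⊎ Δ (ψ ⊖ φ))

  _⊆_ : (Formula → Set) → (Formula → Set) → Set
  Γ ⊆ Δ = ∀ {φ} → Γ φ → Δ φ

  -- sup {p ∈ 𝔻 : p ∸ φ ∈ Δ} = inf {q ∈ 𝔻 : φ ∸ q ∈ Δ}, stated as:
  --   every element of the first set is ≤ every element of the second,
  --   and for every n there are elements p, q of the sets with q ≤ p + 2^{-n}.
  SupEqInf : (Formula → Set) → Formula → Set
  SupEqInf Δ φ =
    (∀ p q → Δ (⌜ p ⌝ ⊖ φ) → Δ (φ ⊖ ⌜ q ⌝) → p ≤ᴰ q)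
    × (∀ n → Σ Dyadic λ p → Σ Dyadic λ q →
         Δ (⌜ p ⌝ ⊖ φ) × Δ (φ ⊖ ⌜ q ⌝) × Within n p q)

-- Call p below φ when p ∸ φ ∈ Δ and above φ when φ ∸ p ∈ Δ. By maximality every dyadic p
-- is below or above φ, and 0 is below, 1 above; so on the grid i / 2ⁿ some consecutive
-- points are below and above φ, which makes the infimum exceed the supremum by at most 2⁻ⁿ.
-- Conversely, p below and q above φ with q < p would give Δ ⊢ p ∸ q, and such a reversed
-- inequality between constants is refutable: unfolding m / 2ᵏ⁺¹ as ½(m / 2ᵏ) or as
-- ¬½¬((m − 2ᵏ) / 2ᵏ) reduces it digit by digit, through the cancellation of ½ (monotone in a
-- theory deciding every comparison), to the provability of a nonzero constant.

module Submission where

open import Defs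
open import Data.Nat using (ℕ; zero; suc; _+_; _*_; _∸_; _^_; _≤_; _<_; _≤ᵇ_; s≤s)
open import Data.Nat.Properties
open import Data.Nat.Solver using (module +-*-Solver)
open import Data.Bool using (true; false; T)
open import Data.Unit using (tt)
open import Data.Product using (Σ; _×_; _,_)
open import Data.Sum using (_⊎_; inj₁; inj₂; [_,_]′)
import Data.Sum as Sum
open import Data.Empty using (⊥-elim)
open import Function using (_∘_)
open import Relation.Nullary using (¬_)
open import Relation.Binary.PropositionalEquality
  using (_≡_; refl; sym; trans; cong; subst; subst₂)

open +-*-Solver using (solve; _:=_; _:+_; _:*_; con)

*-double-cancel-< : ∀ a b x y → a * (2 * x) < b * (2 * y) → a * x < b * y
*-double-cancel-< a b x y lt = *-cancelˡ-< 2 (a * x) (b * y) (subst₂ _<_ (shift a x) (shift b y) lt)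
  where
  shift : ∀ u v → u * (2 * v) ≡ 2 * (u * v)
  shift = solve 2 (λ u v → u :* (con 2 :* v) := con 2 :* (u :* v)) refl

∸-cross-< : ∀ {a b x y} → x ≤ a → y ≤ b → b * (2 * x) < a * (2 * y) → (b ∸ y) * x < (a ∸ x) * y
∸-cross-< {a} {b} {x} {y} x≤a y≤b lt =
  *-cancelˡ-< 2 ((b ∸ y) * x) ((a ∸ x) * y)
    (+-cancelˡ-< (2 * (x * y)) _ _ (subst₂ _<_ (expand y (b ∸ y) x) (expand′ x (a ∸ x) y) lt′))
  where
  lt′ : (y + (b ∸ y)) * (2 * x) < (x + (a ∸ x)) * (2 * y)
  lt′ = subst₂ (λ b′ a′ → b′ * (2 * x) < a′ * (2 * y)) (sym (m+[n∸m]≡n y≤b)) (sym (m+[n∸m]≡n x≤a)) lt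
  expand : ∀ u v w → (u + v) * (2 * w) ≡ 2 * (w * u) + 2 * (v * w)
  expand = solve 3 (λ u v w → (u :+ v) :* (con 2 :* w) := con 2 :* (w :* u) :+ con 2 :* (v :* w)) refl
  expand′ : ∀ u v w → (u + v) * (2 * w) ≡ 2 * (u * w) + 2 * (v * w)
  expand′ = solve 3 (λ u v w → (u :+ v) :* (con 2 :* w) := con 2 :* (u :* w) :+ con 2 :* (v :* w)) refl

half-separates : ∀ {a b x y} → 0 < x → a ≤ x → y < b → ¬ (b * (2 * x) < a * (2 * y))
half-separates {a} {b} {x} {y} 0<x a≤x y<b lt = <-asym lt (begin-strict
  a * (2 * y)     ≤⟨ *-monoˡ-≤ (2 * y) a≤x ⟩
  x * (2 * y)     ≡⟨ solve 2 (λ x y → x :* (con 2 :* y) := y :* (con 2 :* x)) refl x y ⟩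
  y * (2 * x)     <⟨ m<n+m (y * (2 * x)) (≤-trans 0<x (m≤m+n x (x + 0))) ⟩
  suc y * (2 * x) ≤⟨ *-monoˡ-≤ (2 * x) y<b ⟩
  b * (2 * x)     ∎)
  where open ≤-Reasoning

∸-≤-half : ∀ {m x} → m ≤ 2 * x → m ∸ x ≤ x
∸-≤-half {m} {x} m≤2x = m≤n+o⇒m∸n≤o m x (subst (m ≤_) (cong (x +_) (+-identityʳ x)) m≤2x)

∸-<-half : ∀ {m x} → x < m → m < 2 * x → m ∸ x < x
∸-<-half {m} {x} x<m m<2x = +-cancelʳ-< x (m ∸ x) x
  (subst₂ _<_ (sym (m∸n+n≡m (<⇒≤ x<m))) (cong (x +_) (+-identityʳ x)) m<2x)

1ᴰ : Dyadic
1ᴰ = dyadic 1 0 ≤-refl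

fraction : ∀ n i j → i + j ≡ 2 ^ n → Dyadic
fraction n i j i+j≡2ⁿ = dyadic i n (subst (i ≤_) i+j≡2ⁿ (m≤m+n i j))

≤ᴰ⇒Within : ∀ n {p q} → q ≤ᴰ p → Within n p q
≤ᴰ⇒Within n q≤p = ≤-trans (*-monoˡ-≤ (2 ^ n) q≤p) (m≤m+n _ _)

Within-suc : ∀ n {i} (b : i ≤ 2 ^ n) (b′ : suc i ≤ 2 ^ n) →
             Within n (dyadic i n b) (dyadic (suc i) n b′)
Within-suc n {i} _ _ =
  ≤-reflexive (solve 2 (λ i x → (con 1 :+ i) :* x :* x := i :* x :* x :+ x :* x) refl i (2 ^ n))

module Derivations (L : Signature) where
  open Syntax L

  -- φ ∸ ψ has truth value 0 exactly when φ ≤ ψ, so ψ ∸ φ is the Łukasiewicz implication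
  -- φ → ψ; in this notation (A1)–(A4) are Łukasiewicz's axioms and `one` is falsum.
  infixr 25 _⇒_
  _⇒_ : Formula → Formula → Formula
  φ ⇒ ψ = ψ ⊖ φ

  module _ {Γ : Formula → Set} where

    axiom : ∀ {φ} → BaseAxiom φ → Γ ⊢ φ
    axiom = ax ∘ base

    ⇒-const : ∀ {φ} ψ → Γ ⊢ φ → Γ ⊢ ψ ⇒ φ
    ⇒-const {φ} ψ ⊢φ = mp ⊢φ (axiom (A1 φ ψ))

    ⇒-suffix : ∀ {φ ψ} χ → Γ ⊢ φ ⇒ ψ → Γ ⊢ (ψ ⇒ χ) ⇒ (φ ⇒ χ)
    ⇒-suffix χ φ⇒ψ = mp φ⇒ψ (axiom (A2 _ _ χ))

    ⇒-trans : ∀ {φ ψ χ} → Γ ⊢ φ ⇒ ψ → Γ ⊢ ψ ⇒ χ → Γ ⊢ φ ⇒ χ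
    ⇒-trans φ⇒ψ ψ⇒χ = mp ψ⇒χ (⇒-suffix _ φ⇒ψ)

    -- (φ ⇒ ψ) ⇒ ψ is the Łukasiewicz disjunction φ ∨ ψ
    ∨-comm : ∀ {φ ψ} → Γ ⊢ (φ ⇒ ψ) ⇒ ψ → Γ ⊢ (ψ ⇒ φ) ⇒ φ
    ∨-comm φ∨ψ = mp φ∨ψ (axiom (A3 _ _))

    contrapose⁻ : ∀ {φ ψ} → Γ ⊢ neg φ ⇒ neg ψ → Γ ⊢ ψ ⇒ φ
    contrapose⁻ ¬φ⇒¬ψ = mp ¬φ⇒¬ψ (axiom (A4 _ _))

    ⇒-refl : ∀ φ → Γ ⊢ φ ⇒ φ
    ⇒-refl φ = ⇒-trans (axiom (A1 φ ψ)) (∨-comm (⇒-const (φ ⇒ ψ) (axiom (A1 φ φ))))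
      where ψ = φ ⇒ (φ ⇒ φ)

    assertion : ∀ φ ψ → Γ ⊢ φ ⇒ (φ ⇒ ψ) ⇒ ψ
    assertion φ ψ = ⇒-trans (axiom (A1 φ (ψ ⇒ φ))) (axiom (A3 ψ φ))

    ⇒-exchange : ∀ {φ ψ χ} → Γ ⊢ φ ⇒ ψ ⇒ χ → Γ ⊢ ψ ⇒ φ ⇒ χ
    ⇒-exchange {ψ = ψ} {χ} p = ⇒-trans (assertion ψ χ) (⇒-suffix χ p)

    ⇒-prefix : ∀ {φ ψ} χ → Γ ⊢ φ ⇒ ψ → Γ ⊢ (χ ⇒ φ) ⇒ (χ ⇒ ψ)
    ⇒-prefix χ φ⇒ψ = mp φ⇒ψ (⇒-exchange (axiom (A2 χ _ _)))

    ¬¬-elim : ∀ φ → Γ ⊢ neg (neg φ) ⇒ φ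
    ¬¬-elim φ =
      ⇒-trans (⇒-trans (⇒-trans (axiom (A1 (neg (neg φ)) (neg (neg ⊤̇))))
                                (axiom (A4 (neg ⊤̇) (neg φ))))
                       (axiom (A4 φ ⊤̇)))
              (∨-comm (⇒-const (φ ⇒ ⊤̇) (⇒-refl φ)))
      where ⊤̇ = φ ⇒ φ

    ¬¬-intro : ∀ φ → Γ ⊢ φ ⇒ neg (neg φ)
    ¬¬-intro φ = contrapose⁻ (¬¬-elim (neg φ))

    contraposition : ∀ φ ψ → Γ ⊢ (φ ⇒ ψ) ⇒ (neg ψ ⇒ neg φ)
    contraposition φ ψ =
      ⇒-trans (⇒-trans (⇒-prefix φ (¬¬-intro ψ)) (⇒-suffix (neg (neg ψ)) (¬¬-elim φ)))
              (axiom (A4 (neg φ) (neg ψ)))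

    contrapose : ∀ {φ ψ} → Γ ⊢ φ ⇒ ψ → Γ ⊢ neg ψ ⇒ neg φ
    contrapose φ⇒ψ = mp φ⇒ψ (contraposition _ _)

    ⊢zero : Γ ⊢ zeroF
    ⊢zero = ⇒-refl one

    ex-falso : ∀ φ → Γ ⊢ one ⇒ φ
    ex-falso φ = contrapose⁻ (⇒-const (neg φ) (mp (⇒-refl σ₀) (¬¬-intro (σ₀ ⇒ σ₀))))

    ¬⇒one : ∀ φ → Γ ⊢ neg φ ⇒ φ ⇒ one
    ¬⇒one φ = ⇒-trans (axiom (A1 (neg φ) (neg one))) (axiom (A4 one φ))

    ⊢-of-¬⇒one : ∀ {φ} → Γ ⊢ neg φ ⇒ one → Γ ⊢ φ
    ⊢-of-¬⇒one ¬φ⇒one = mp ⊢zero (contrapose⁻ (⇒-trans ¬φ⇒one (ex-falso (neg zeroF))))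

    ⊢-half : ∀ {φ} → Γ ⊢ φ → Γ ⊢ half φ
    ⊢-half {φ} ⊢φ = mp (⇒-const (half φ) ⊢φ) (axiom (A5 φ))

    ⊢-half⁻¹ : ∀ {φ} → Γ ⊢ half φ → Γ ⊢ φ
    ⊢-half⁻¹ {φ} ⊢½φ = mp ⊢½φ (mp ⊢½φ (axiom (A6 φ)))

    ⊢-of-half⇒ : ∀ {φ} → Γ ⊢ half φ ⇒ φ → Γ ⊢ φ
    ⊢-of-half⇒ {φ} ½φ⇒φ = ⊢-half⁻¹ (mp ½φ⇒φ (axiom (A5 φ)))

    ¬half-one⇒half-one : Γ ⊢ neg (half one) ⇒ half one
    ¬half-one⇒half-one = ⇒-trans (¬⇒one (half one)) (axiom (A5 one))

    half-cancel : ∀ {φ ψ} → Γ ⊢ half φ ⇒ half ψ → Γ ⊢ φ ⇒ ψ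
    half-cancel {φ} {ψ} ½φ⇒½ψ =
      ⇒-trans doubling (contrapose⁻ (⇒-trans (⇒-exchange twice) (¬¬-intro _)))
      where
      -- ¬(χ ⇒ ¬χ) takes the value min(1, χ + χ)
      doubling : Γ ⊢ φ ⇒ neg (half φ ⇒ neg (half φ))
      doubling = contrapose⁻ (⇒-trans (¬¬-elim _) halves⇒¬φ)
        where
        φ⇒½φ : Γ ⊢ φ ⇒ half φ
        φ⇒½φ = ⇒-trans (axiom (A1 φ (half φ))) (axiom (A5 φ))
        halves⇒¬φ : Γ ⊢ (half φ ⇒ neg (half φ)) ⇒ neg φ
        halves⇒¬φ =
          ⇒-trans (⇒-suffix (neg (half φ)) (axiom (A5 φ)))
            (⇒-trans (⇒-suffix (neg (half φ)) (axiom (A4 φ (half φ))))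
              (⇒-trans (axiom (A3 (neg φ) (neg (half φ))))
                (mp (contrapose φ⇒½φ) (assertion _ (neg φ)))))
      twice : Γ ⊢ half φ ⇒ neg ψ ⇒ neg (half φ)
      twice = ⇒-trans (⇒-trans ½φ⇒½ψ (⇒-trans (axiom (A6 ψ)) (⇒-suffix ψ ½φ⇒½ψ)))
                      (contraposition (half φ) ψ)

  ⊢dyF-zero : ∀ {Γ} n → Γ ⊢ dyF 0 n
  ⊢dyF-zero zero    = ⊢zero
  ⊢dyF-zero (suc n) = ⊢-half (⊢dyF-zero n)

  data HalfExpansion (m k : ℕ) : Formula → Set where
    lower : m ≤ 2 ^ k → HalfExpansion m k (half (dyF m k))
    upper : 2 ^ k < m → HalfExpansion m k (neg (half (neg (dyF (m ∸ 2 ^ k) k))))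

  halfExpansion : ∀ m k → HalfExpansion m k (dyF m (suc k))
  halfExpansion m k with m ≤ᵇ 2 ^ k in eq
  ... | true  = lower (≤ᵇ⇒≤ m (2 ^ k) (subst T (sym eq) tt))
  ... | false = upper (≰⇒> (λ m≤ → subst T eq (≤⇒≤ᵇ m≤)))

  module Prelinear {Δ : Formula → Set} (prelinear : ∀ φ ψ → Δ ⊢ φ ⇒ ψ ⊎ Δ ⊢ ψ ⇒ φ) where

    half-mono : ∀ {φ ψ} → Δ ⊢ φ ⇒ ψ → Δ ⊢ half φ ⇒ half ψ
    half-mono {φ} {ψ} φ⇒ψ with prelinear (half φ) (half ψ)
    ... | inj₁ ½φ⇒½ψ = ½φ⇒½ψ
    ... | inj₂ ½ψ⇒½φ =
      ⇒-trans (axiom (A6 φ))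
        (⇒-trans (⇒-prefix (half φ) φ⇒ψ) (⇒-trans (⇒-suffix ψ ½ψ⇒½φ) (axiom (A5 ψ))))

    refute-half⇒one : ∀ {φ} → Δ ⊢ half φ ⇒ one → Δ ⊢ one
    refute-half⇒one {φ} ½φ⇒one = ⊢-of-half⇒ (⇒-trans (half-mono (ex-falso φ)) ½φ⇒one)

    refute-¬half¬ : ∀ {φ} → Δ ⊢ neg (half (neg φ)) → Δ ⊢ one
    refute-¬half¬ {φ} ⊢¬½¬φ =
      ⊢-half⁻¹ (mp (mp ⊢¬½¬φ (contrapose (half-mono (ex-falso (neg φ))))) ¬half-one⇒half-one)

    ¬half¬⇒one-elim : ∀ {φ} → Δ ⊢ neg (half (neg φ)) ⇒ one → Δ ⊢ φ ⇒ one
    ¬half¬⇒one-elim {φ} ¬½¬φ⇒one = mp (⊢-half⁻¹ (⊢-of-¬⇒one ¬½¬φ⇒one)) (¬⇒one φ)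

    ⊢-of-half⇒¬half¬ : ∀ {φ ψ} → Δ ⊢ half ψ ⇒ neg (half (neg φ)) → Δ ⊢ φ
    ⊢-of-half⇒¬half¬ {φ} {ψ} ½ψ⇒¬½¬φ = ⊢-of-¬⇒one (half-cancel ½¬φ⇒½one)
      where
      ½one⇒¬½¬φ : Δ ⊢ half one ⇒ neg (half (neg φ))
      ½one⇒¬½¬φ = ⇒-trans (half-mono (ex-falso ψ)) ½ψ⇒¬½¬φ
      ½¬φ⇒½one : Δ ⊢ half (neg φ) ⇒ half one
      ½¬φ⇒½one = ⇒-trans (¬¬-intro _) (⇒-trans (contrapose ½one⇒¬½¬φ) ¬half-one⇒half-one)

    refute-below-one : ∀ m k → m < 2 ^ k → Δ ⊢ dyF m k ⇒ one → Δ ⊢ one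
    refute-below-one zero    zero _          ⊢0⇒one = mp ⊢zero ⊢0⇒one
    refute-below-one (suc _) zero (s≤s ()) _
    refute-below-one m (suc k) m<2ᵏ⁺¹ h with dyF m (suc k) | halfExpansion m k
    ... | _ | lower _    = refute-half⇒one h
    ... | _ | upper 2ᵏ<m = refute-below-one (m ∸ 2 ^ k) k (∸-<-half 2ᵏ<m m<2ᵏ⁺¹) (¬half¬⇒one-elim h)

    refute-positive : ∀ m k → m ≤ 2 ^ k → 0 < m → Δ ⊢ dyF m k → Δ ⊢ one
    refute-positive (suc zero) zero _ _ ⊢one = ⊢one
    refute-positive (suc (suc _)) zero (s≤s ()) _ _
    refute-positive m (suc k) _ 0<m h with dyF m (suc k) | halfExpansion m k
    ... | _ | lower m≤2ᵏ = refute-positive m k m≤2ᵏ 0<m (⊢-half⁻¹ h)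
    ... | _ | upper _    = refute-¬half¬ h

    refute-reversed : ∀ m₁ k₁ m₂ k₂ → m₁ ≤ 2 ^ k₁ → m₂ ≤ 2 ^ k₂ → m₂ * 2 ^ k₁ < m₁ * 2 ^ k₂ →
                      Δ ⊢ dyF m₂ k₂ ⇒ dyF m₁ k₁ → Δ ⊢ one
    refute-reversed zero          zero _ _ _        _ () _
    refute-reversed (suc zero)    zero m₂ k₂ _      _ lt h =
      refute-below-one m₂ k₂ (subst₂ _<_ (*-identityʳ m₂) (*-identityˡ (2 ^ k₂)) lt) h
    refute-reversed (suc (suc _)) zero _ _ (s≤s ()) _ _ _
    refute-reversed m₁ k₁ zero          zero b₁ _ lt h =
      refute-positive m₁ k₁ b₁ (subst (0 <_) (*-identityʳ m₁) lt) (mp ⊢zero h)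
    refute-reversed m₁ k₁ (suc zero)    zero b₁ _ lt _ =
      ⊥-elim (<⇒≱ lt (subst₂ _≤_ (sym (*-identityʳ m₁)) (sym (*-identityˡ (2 ^ k₁))) b₁))
    refute-reversed _  _  (suc (suc _)) zero _ (s≤s ()) _ _
    refute-reversed m₁ (suc k₁) m₂ (suc k₂) b₁ b₂ lt h
      with dyF m₁ (suc k₁) | halfExpansion m₁ k₁ | dyF m₂ (suc k₂) | halfExpansion m₂ k₂
    ... | _ | lower b₁′  | _ | lower b₂′  =
      refute-reversed m₁ k₁ m₂ k₂ b₁′ b₂′ (*-double-cancel-< m₂ m₁ _ _ lt) (half-cancel h)
    ... | _ | upper 2ᵏ¹<m₁ | _ | upper 2ᵏ²<m₂ =
      refute-reversed (m₁ ∸ 2 ^ k₁) k₁ (m₂ ∸ 2 ^ k₂) k₂ (∸-≤-half b₁) (∸-≤-half b₂)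
        (∸-cross-< (<⇒≤ 2ᵏ¹<m₁) (<⇒≤ 2ᵏ²<m₂) lt) (contrapose⁻ (half-cancel (contrapose⁻ h)))
    ... | _ | upper 2ᵏ¹<m₁ | _ | lower _    =
      refute-positive (m₁ ∸ 2 ^ k₁) k₁ (∸-≤-half b₁) (m<n⇒0<n∸m 2ᵏ¹<m₁) (⊢-of-half⇒¬half¬ h)
    ... | _ | lower m₁≤2ᵏ¹ | _ | upper 2ᵏ²<m₂ = ⊥-elim (half-separates (m^n>0 2 k₁) m₁≤2ᵏ¹ 2ᵏ²<m₂ lt)

  module MaximallyConsistent {Δ : Formula → Set}
    (consistent : Consistent Δ)
    (closed : ∀ φ → (∀ n → Δ ⊢ (φ ⊖ twoPow⁻ n)) → Δ φ)
    (linear : ∀ φ ψ → Δ (φ ⊖ ψ) ⊎ Δ (ψ ⊖ φ))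
    where

    ⊢⇒∈ : ∀ {φ} → Δ ⊢ φ → Δ φ
    ⊢⇒∈ {φ} ⊢φ = closed φ (λ n → ⇒-const (twoPow⁻ n) ⊢φ)

    open Prelinear {Δ} (λ φ ψ → Sum.map hyp hyp (linear ψ φ))

    ⊬one : ¬ Δ ⊢ one
    ⊬one ⊢one = consistent (λ ψ → mp ⊢one (ex-falso ψ))

    below≤ᴰabove : ∀ φ p q → Δ (⌜ p ⌝ ⊖ φ) → Δ (φ ⊖ ⌜ q ⌝) → p ≤ᴰ q
    below≤ᴰabove φ p q p≤φ φ≤q = ≮⇒≥ λ q<p →
      ⊬one (refute-reversed (num p) (exp p) (num q) (exp q) (bounded p) (bounded q) q<p
             (⇒-trans (hyp φ≤q) (hyp p≤φ)))

    Bracket : Formula → ℕ → Set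
    Bracket φ n = Σ Dyadic λ p → Σ Dyadic λ q → Δ (⌜ p ⌝ ⊖ φ) × Δ (φ ⊖ ⌜ q ⌝) × Within n p q

    -- walk up the grid i / 2ⁿ while i / 2ⁿ stays below φ; linearity stops the walk
    -- at the first grid point above φ, or else it reaches 1, which is above φ anyway
    scan : ∀ φ n i j (i+j≡2ⁿ : i + j ≡ 2 ^ n) → Δ (⌜ fraction n i j i+j≡2ⁿ ⌝ ⊖ φ) → Bracket φ n
    scan φ n i zero i+0≡2ⁿ i≤φ =
      p , 1ᴰ , i≤φ , ⊢⇒∈ (ex-falso φ) , ≤ᴰ⇒Within n {p} {1ᴰ} 1≤p
      where
      p : Dyadic
      p = fraction n i 0 i+0≡2ⁿ
      1≤p : 1ᴰ ≤ᴰ p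
      1≤p = ≤-reflexive (trans (*-identityˡ (2 ^ n))
              (sym (trans (*-identityʳ i) (trans (sym (+-identityʳ i)) i+0≡2ⁿ))))
    scan φ n i (suc j) i+j≡2ⁿ i≤φ =
      [ scan φ n (suc i) j i+1+j≡2ⁿ
      , (λ φ≤i+1 → p , q , i≤φ , φ≤i+1 , Within-suc n (bounded p) (bounded q))
      ]′ (linear ⌜ q ⌝ φ)
      where
      i+1+j≡2ⁿ : suc i + j ≡ 2 ^ n
      i+1+j≡2ⁿ = trans (sym (+-suc i j)) i+j≡2ⁿ
      p q : Dyadic
      p = fraction n i (suc j) i+j≡2ⁿ
      q = fraction n (suc i) j i+1+j≡2ⁿ

    bracket : ∀ φ n → Bracket φ n
    bracket φ n = scan φ n 0 (2 ^ n) refl (⊢⇒∈ (⇒-const φ (⊢dyF-zero n)))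

lemma8p12 : (L : Signature) → let open Syntax L in
    (Γ Δ : Formula → Set) (φ : Formula) →
    Consistent Γ → MaximalConsistent Δ → Γ ⊆ Δ →
    SupEqInf Δ φ
lemma8p12 L _ Δ φ _ (consistent , closed , linear) _ = below≤ᴰabove φ , bracket φ
  where open Derivations L
        open MaximallyConsistent consistent closed linear
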